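{- Let $\pi$ be an $\mathsf{MLL}^-$ proof net, and let $A$ and $B$ be subformula occurrences appearing in $\pi$. If $A\ll B$ and $B\ll A$, then either $A$ and $B$ are the same occurrence, or they are dual atoms connected via an identity link.
   Context: $\mathsf{MLL}^-$ formulas: over atoms $a,a^\perp$, $F ::= a\mid a^\perp\mid F\wp F\mid F\otimes F$ ($\wp$ = par), negation $a^{\perp\perp}=a$, $(A\otimes B)^\perp=B^\perp\wp A^\perp$, $(A\wp B)^\perp=B^\perp\otimes A^\perp$. A pre-proof net: finite list of formula trees, finitely many cuts (trees with root $A\oslash A^\perp$, children the trees of $A$, $A^\perp$), and a perfect matching (linking; its pairs are called identity links) of all leaves pairing occurrences of $a$ with occurrences of $a^\perp$; viewed as a graph. A switching deletes, for each $\wp$-node, one of its two child edges; correct (= proof net) means all switchings connected and acyclic. $\sigma$ is a subprenet of $\pi$ if all formulas/cuts of $\sigma$ are subformula/cut occurrences of $\pi$ and its linking is the restriction of $\pi$'s; a subnet is a subprenet with $\sigma$, $\pi$ both correct; a door of $\sigma$ is a conclusion (root) of $\sigma$. The kingdom $kA$ of a subformula/cut occurrence $A$ in $\pi$ is the smallest subnet of $\pi$ having $A$ as a door (it exists). For (sub)formula/cut occurrences $A,B$ of $\pi$, define $A\ll B$ iff $A\in kB$. -}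

module Defs where

open import Data.Nat using (ℕ; suc)
open import Data.Fin using (Fin; zero; suc; inject₁; fromℕ)
open import Data.Unit using (⊤)
open import Data.Empty using (⊥)
open import Data.Product using (Σ; _×_; _,_)
open import Data.Sum using (_⊎_)
open import Relation.Nullary using (¬_)
open import Relation.Binary.PropositionalEquality using (_≡_; _≢_)
open import Relation.Binary.Construct.Closure.ReflexiveTransitive using (Star)

data Conn : Set where
  tens par : Conn

data Formula : Set where
  pos : ℕ → Formula
  neg : ℕ → Formula
  bin : Conn → Formula → Formula → Formula

_ᗮ : Formula → Formula
pos a ᗮ = neg a
neg a ᗮ = pos a
bin tens A B ᗮ = bin par (B ᗮ) (A ᗮ)
bin par  A B ᗮ = bin tens (B ᗮ) (A ᗮ)

IsAtomic : Formula → Set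
IsAtomic (pos _) = ⊤
IsAtomic (neg _) = ⊤
IsAtomic (bin _ _ _) = ⊥

data Side : Set where
  left right : Side

data Pos : Formula → Set where
  here : ∀ {F} → Pos F
  L : ∀ {c A B} → Pos A → Pos (bin c A B)
  R : ∀ {c A B} → Pos B → Pos (bin c A B)

sub : ∀ {F} → Pos F → Formula
sub {F} here = F
sub (L p) = sub p
sub (R p) = sub p

data Step : ∀ {F} → Pos F → Pos F → Side → Set where
  stepL : ∀ {c A B} → Step {bin c A B} here (L here) left
  stepR : ∀ {c A B} → Step {bin c A B} here (R here) right
  inL : ∀ {c A B p q d} → Step {A} p q d → Step {bin c A B} (L p) (L q) d
  inR : ∀ {c A B p q d} → Step {B} p q d → Step {bin c A B} (R p) (R q) d

record Trees : Set where
  field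
    nc    : ℕ
    concl : Fin nc → Formula
    nk    : ℕ
    cuts  : Fin nk → Formula   -- cut j is the tree  A ⊘ A^⊥  with A = cuts j
open Trees public

data Occ (T : Trees) : Set where
  conc : (i : Fin (nc T)) → Pos (concl T i) → Occ T
  cutL : (j : Fin (nk T)) → Pos (cuts T j) → Occ T
  cutR : (j : Fin (nk T)) → Pos (cuts T j ᗮ) → Occ T

fmla : ∀ {T} → Occ T → Formula
fmla (conc i p) = sub p
fmla (cutL j p) = sub p
fmla (cutR j p) = sub p

data Node (T : Trees) : Set where
  occ  : Occ T → Node T
  cutN : Fin (nk T) → Node T

data Child (T : Trees) : Node T → Node T → Side → Set where
  conc-step : ∀ {i p q d} → Step p q d → Child T (occ (conc i p)) (occ (conc i q)) d
  cutL-step : ∀ {j p q d} → Step p q d → Child T (occ (cutL j p)) (occ (cutL j q)) d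
  cutR-step : ∀ {j p q d} → Step p q d → Child T (occ (cutR j p)) (occ (cutR j q)) d
  cut-left  : ∀ {j} → Child T (cutN j) (occ (cutL j here)) left
  cut-right : ∀ {j} → Child T (cutN j) (occ (cutR j here)) right

record PreNet : Set₁ where
  field
    trees  : Trees
    Linked : Occ trees → Occ trees → Set
    linked-sym    : ∀ {x y} → Linked x y → Linked y x
    linked-dual   : ∀ {x y} → Linked x y →
                    Σ ℕ λ a → (fmla x ≡ pos a × fmla y ≡ neg a)
                            ⊎ (fmla x ≡ neg a × fmla y ≡ pos a)
    linked-total  : ∀ x → IsAtomic (fmla x) → Σ (Occ trees) λ y → Linked x y
    linked-unique : ∀ {x y z} → Linked x y → Linked x z → y ≡ z
open PreNet public

module _ (π : PreNet) where
  private T = trees π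

  NodeSet : Set₁
  NodeSet = Node T → Set

  -- a switching: for each ⅋-node, the side of the child edge that is deleted
  -- (values at non-⅋ nodes are ignored)
  Switching : Set
  Switching = Occ T → Side

  keptAt : Formula → Side → Side → Set
  keptAt (bin par _ _) del d = del ≢ d
  keptAt _ _ _ = ⊤

  KeptAt : Switching → Node T → Side → Set
  KeptAt s (occ x)  d = keptAt (fmla x) (s x) d
  KeptAt s (cutN _) d = ⊤

  KeptChild : Switching → Node T → Node T → Set
  KeptChild s u v = Σ Side λ d → Child T u v d × KeptAt s u d

  LinkEdge : Node T → Node T → Set
  LinkEdge (occ x) (occ y) = Linked π x y
  LinkEdge _ _ = ⊥

  Edge : Switching → Node T → Node T → Set
  Edge s u v = KeptChild s u v ⊎ KeptChild s v u ⊎ LinkEdge u v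

  Adj : NodeSet → Switching → Node T → Node T → Set
  Adj S s u v = S u × S v × Edge s u v

  Connected : NodeSet → Switching → Set
  Connected S s = ∀ u v → S u → S v → Star (Adj S s) u v

  -- a cycle: k+3 pairwise distinct vertices, cyclically adjacent
  -- (the graphs are simple, so this is the usual notion of cycle)
  Cycle : NodeSet → Switching → Set
  Cycle S s = Σ ℕ λ k → Σ (Fin (suc (suc (suc k))) → Node T) λ v →
                (∀ i j → v i ≡ v j → i ≡ j)
              × (∀ (i : Fin (suc (suc k))) → Adj S s (v (inject₁ i)) (v (suc i)))
              × Adj S s (v (fromℕ (suc (suc k)))) (v zero)

  Acyclic : NodeSet → Switching → Set
  Acyclic S s = ¬ Cycle S s

  Correct : NodeSet → Set
  Correct S = ∀ s → Connected S s × Acyclic S s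

  Full : NodeSet
  Full _ = ⊤

  -- a sub-prenet: closed under subformulas (its trees are full subtrees of π)
  -- and under the linking of π (its linking is the restriction of π's)
  SubPreNet : NodeSet → Set
  SubPreNet S = (∀ u v d → S u → Child T u v d → S v)
              × (∀ x y → S (occ x) → Linked π x y → S (occ y))

  Subnet : NodeSet → Set
  Subnet S = SubPreNet S × Correct S × Correct Full

  Door : NodeSet → Node T → Set
  Door S u = S u × (∀ p d → Child T p u d → ¬ S p)

  Kingdom : Node T → NodeSet → Set₁
  Kingdom X S = Subnet S × Door S X
              × (∀ S′ → Subnet S′ → Door S′ X → ∀ u → S u → S′ u)

  _≪_ : Node T → Node T → Set₁
  A ≪ B = Σ NodeSet λ S → Kingdom B S × S A

ProofNet : PreNet → Set
ProofNet π = Correct π (Full π)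

module Submission where

-- If A is an atom, A together with its linked dual is already a subnet with door A, so the
-- kingdom of A, and with it B, lies inside this identity link. Otherwise, if B ≠ A, we exhibit a subnet
-- containing B but not A: intersecting it with kB (two subnets sharing a node intersect in a
-- subnet, since switching graphs are forests) shows A ∉ kB. For a ⅋-door A, the kingdom kA
-- without A is such a subnet, as A is a leaf of every switching graph of kA. For a ⊗-door A
-- with children n₁, n₂, removing A splits every switching graph of kA into the part reaching
-- n₁ and the part reaching n₂; the nodes on the side of nᵢ in every switching form a subnet
-- Cᵢ, and by minimality kA = {A} ∪ C₁ ∪ C₂, so B lies in some Cᵢ.

open import Defs
open import Data.Nat using (ℕ; zero; suc; _≤_; z≤n; s≤s)
open import Data.Fin using (Fin; zero; suc; inject₁; fromℕ)
import Data.Fin.Properties as Fin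
open import Data.Unit using (⊤; tt)
open import Data.Empty using (⊥; ⊥-elim)
open import Data.Product using (Σ; _×_; _,_; proj₁; proj₂)
open import Data.Sum using (_⊎_; inj₁; inj₂)
import Data.Sum as Sum
open import Relation.Nullary using (¬_; Dec; yes; no)
open import Relation.Nullary.Decidable using (map′; _⊎-dec_; ¬¬-excluded-middle)
open import Relation.Nullary.Negation using (DoubleNegation)
open import Relation.Unary using (_∩_; _⊆_)
open import Relation.Binary.Definitions using (DecidableEquality; Sym)
open import Relation.Binary.PropositionalEquality using (_≡_; _≢_; refl; sym; trans; cong; subst)
open import Relation.Binary.Construct.Closure.ReflexiveTransitive using (Star; ε; _◅_; _◅◅_; revApp; reverse)
import Relation.Binary.Construct.Closure.ReflexiveTransitive as Star

-- Walks in a graph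

module Walk {V : Set} (_≟_ : DecidableEquality V) where

  CycleIn : (V → V → Set) → Set
  CycleIn G = Σ ℕ λ k → Σ (Fin (suc (suc (suc k))) → V) λ v →
                (∀ i j → v i ≡ v j → i ≡ j)
              × (∀ (i : Fin (suc (suc k))) → G (v (inject₁ i)) (v (suc i)))
              × G (v (fromℕ (suc (suc k)))) (v zero)

  module _ {G : V → V → Set} where

    _∈ʷ_ : ∀ {x y} → V → Star G x y → Set
    _∈ʷ_ {x = x} w ε = w ≡ x
    _∈ʷ_ {x = x} w (_ ◅ p) = w ≡ x ⊎ w ∈ʷ p

    _∈ʷ?_ : ∀ {x y} (w : V) (p : Star G x y) → Dec (w ∈ʷ p)
    _∈ʷ?_ {x = x} w ε = w ≟ x
    _∈ʷ?_ {x = x} w (_ ◅ p) = (w ≟ x) ⊎-dec (w ∈ʷ? p)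

    _⊆ʷ_ : ∀ {x y x′ y′} → Star G x y → Star G x′ y′ → Set
    p ⊆ʷ q = ∀ w → w ∈ʷ p → w ∈ʷ q

    source∈ʷ : ∀ {x y} (p : Star G x y) → x ∈ʷ p
    source∈ʷ ε = refl
    source∈ʷ (_ ◅ p) = inj₁ refl

    Simple : ∀ {x y} → Star G x y → Set
    Simple ε = ⊤
    Simple {x = x} (_ ◅ p) = ¬ x ∈ʷ p × Simple p

    length : ∀ {x y} → Star G x y → ℕ
    length ε = 0
    length (_ ◅ p) = suc (length p)

    suffix : ∀ {w x y} (p : Star G x y) → w ∈ʷ p →
             Σ (Star G w y) λ q → (Simple p → Simple q) × q ⊆ʷ p
    suffix ε refl = ε , (λ s → s) , λ _ w∈ → w∈
    suffix (r ◅ p) (inj₁ refl) = r ◅ p , (λ s → s) , λ _ w∈ → w∈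
    suffix (r ◅ p) (inj₂ w∈) with suffix p w∈
    ... | q , simple , q⊆p = q , (λ s → simple (proj₂ s)) , λ v v∈ → inj₂ (q⊆p v v∈)

    simplify : ∀ {x y} (p : Star G x y) → Σ (Star G x y) λ q → Simple q × q ⊆ʷ p
    simplify ε = ε , tt , λ _ w∈ → w∈
    simplify {x = x} (r ◅ p) with simplify p
    ... | q , simple , q⊆p with x ∈ʷ? q
    ...   | yes x∈q = let q′ , simple′ , q′⊆q = suffix q x∈q
                      in q′ , simple′ simple , λ v v∈ → inj₂ (q⊆p v (q′⊆q v v∈))
    ...   | no x∉q = r ◅ q , (x∉q , simple) , λ { v (inj₁ v≡x) → inj₁ v≡x ; v (inj₂ v∈) → inj₂ (q⊆p v v∈) }

    walk-preserves : (P : V → Set) → (∀ {a b} → G a b → P b) →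
                     ∀ {x y} → P x → (p : Star G x y) → ∀ w → w ∈ʷ p → P w
    walk-preserves P step Px ε w refl = Px
    walk-preserves P step Px (r ◅ p) w (inj₁ refl) = Px
    walk-preserves P step Px (r ◅ p) w (inj₂ w∈) = walk-preserves P step (step r) p w w∈

    map-within : ∀ {G′ : V → V → Set} (P : V → Set) → (∀ {a b} → P a → P b → G a b → G′ a b) →
                 ∀ {x y} (p : Star G x y) → (∀ w → w ∈ʷ p → P w) → Star G′ x y
    map-within P f ε inside = ε
    map-within P f (r ◅ p) inside =
      f (inside _ (inj₁ refl)) (inside _ (inj₂ (source∈ʷ p))) r ◅ map-within P f p (λ w w∈ → inside w (inj₂ w∈))

    ∈ʷ-revApp : ∀ (f : Sym G G) {x y z w} (p : Star G y x) (q : Star G y z) →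
                w ∈ʷ revApp f p q → w ∈ʷ p ⊎ w ∈ʷ q
    ∈ʷ-revApp f ε q w∈ = inj₂ w∈
    ∈ʷ-revApp f (r ◅ p) q w∈ with ∈ʷ-revApp f p (f r ◅ q) w∈
    ... | inj₁ w∈p = inj₁ (inj₂ w∈p)
    ... | inj₂ (inj₁ refl) = inj₁ (inj₂ (source∈ʷ p))
    ... | inj₂ (inj₂ w∈q) = inj₂ w∈q

    ∈ʷ-reverse : ∀ (f : Sym G G) {x y w} (p : Star G x y) → w ∈ʷ reverse f p → w ∈ʷ p
    ∈ʷ-reverse f p w∈ with ∈ʷ-revApp f p ε w∈
    ... | inj₁ w∈p = w∈p
    ... | inj₂ refl = source∈ʷ p

    interior-neighbours : ∀ {x y w} (p : Star G x y) → Simple p → w ∈ʷ p → w ≢ x → w ≢ y →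
                          Σ V λ a → Σ V λ b → G a w × G w b × a ≢ b
    interior-neighbours ε _ refl w≢x _ = ⊥-elim (w≢x refl)
    interior-neighbours (r ◅ p) _ (inj₁ w≡x) w≢x _ = ⊥-elim (w≢x w≡x)
    interior-neighbours {w = w} (_◅_ {j = z} _ p) (_ , simple) (inj₂ w∈) _ w≢y with w ≟ z
    interior-neighbours (r ◅ ε) _ (inj₂ _) _ w≢y | yes refl = ⊥-elim (w≢y refl)
    interior-neighbours {x = x} (_◅_ r (_◅_ {j = z′} r′ p)) (x∉p , _) (inj₂ _) _ _ | yes refl =
      x , z′ , r , r′ , λ x≡z′ → x∉p (inj₂ (subst (_∈ʷ p) (sym x≡z′) (source∈ʷ p)))
    ... | no w≢z = interior-neighbours p simple w∈ w≢z w≢y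

    private
      vertex : ∀ {x y} (p : Star G x y) → Fin (suc (length p)) → V
      vertex {x = x} p zero = x
      vertex (r ◅ p) (suc i) = vertex p i

      vertex∈ʷ : ∀ {x y} (p : Star G x y) (i : Fin (suc (length p))) → vertex p i ∈ʷ p
      vertex∈ʷ p zero = source∈ʷ p
      vertex∈ʷ (r ◅ p) (suc i) = inj₂ (vertex∈ʷ p i)

      vertex-last : ∀ {x y} (p : Star G x y) → vertex p (fromℕ (length p)) ≡ y
      vertex-last ε = refl
      vertex-last (r ◅ p) = vertex-last p

      vertex-step : ∀ {x y} (p : Star G x y) (i : Fin (length p)) → G (vertex p (inject₁ i)) (vertex p (suc i))
      vertex-step (r ◅ p) zero = r
      vertex-step (r ◅ p) (suc i) = vertex-step p i

      vertex-injective : ∀ {x y} (p : Star G x y) → Simple p → ∀ i j → vertex p i ≡ vertex p j → i ≡ j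
      vertex-injective p _ zero zero _ = refl
      vertex-injective (r ◅ p) (x∉p , _) zero (suc j) eq = ⊥-elim (x∉p (subst (_∈ʷ p) (sym eq) (vertex∈ʷ p j)))
      vertex-injective (r ◅ p) (x∉p , _) (suc i) zero eq = ⊥-elim (x∉p (subst (_∈ʷ p) eq (vertex∈ʷ p i)))
      vertex-injective (r ◅ p) (_ , simple) (suc i) (suc j) eq = cong suc (vertex-injective p simple i j eq)

    simple-walk-cycle : ∀ {G′ : V → V → Set} → (∀ {a b} → G a b → G′ a b) →
                        ∀ {x y} (p : Star G x y) → Simple p → 2 ≤ length p → G′ y x → CycleIn G′
    simple-walk-cycle {G′} f {x} p@(_ ◅ _ ◅ q) simple (s≤s (s≤s _)) back =
      length q , vertex p , vertex-injective p simple , (λ i → f (vertex-step p i)) ,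
      subst (λ v → G′ v x) (sym (vertex-last p)) back

-- Formula trees

IsBinary : Formula → Set
IsBinary F = Σ Conn λ c → Σ Formula λ X → Σ Formula λ Y → F ≡ bin c X Y

binary-or-atomic : (F : Formula) → IsBinary F ⊎ IsAtomic F
binary-or-atomic (pos _) = inj₂ tt
binary-or-atomic (neg _) = inj₂ tt
binary-or-atomic (bin c X Y) = inj₁ (c , X , Y , refl)

binary⇒¬atomic : ∀ {F} → IsBinary F → ¬ IsAtomic F
binary⇒¬atomic (_ , _ , _ , refl) ()

_≟ᴾ_ : ∀ {F} → DecidableEquality (Pos F)
here ≟ᴾ here = yes refl
L p ≟ᴾ L q = map′ (cong L) (λ { refl → refl }) (p ≟ᴾ q)
R p ≟ᴾ R q = map′ (cong R) (λ { refl → refl }) (p ≟ᴾ q)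
here ≟ᴾ L _ = no λ ()
here ≟ᴾ R _ = no λ ()
L _ ≟ᴾ here = no λ ()
L _ ≟ᴾ R _ = no λ ()
R _ ≟ᴾ here = no λ ()
R _ ≟ᴾ L _ = no λ ()

step-irreflexive : ∀ {F} {p : Pos F} {d} → ¬ Step p p d
step-irreflexive (inL s) = step-irreflexive s
step-irreflexive (inR s) = step-irreflexive s

step-functional : ∀ {F} {p q q′ : Pos F} {d} → Step p q d → Step p q′ d → q ≡ q′
step-functional stepL stepL = refl
step-functional stepR stepR = refl
step-functional (inL s) (inL s′) = cong L (step-functional s s′)
step-functional (inR s) (inR s′) = cong R (step-functional s s′)

step-side-unique : ∀ {F} {p q : Pos F} → Step p q left → ¬ Step p q right
step-side-unique (inL s) (inL s′) = step-side-unique s s′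
step-side-unique (inR s) (inR s′) = step-side-unique s s′

step-parent-binary : ∀ {F} {p q : Pos F} {d} → Step p q d → IsBinary (sub p)
step-parent-binary (stepL {c} {A} {B}) = c , A , B , refl
step-parent-binary (stepR {c} {A} {B}) = c , A , B , refl
step-parent-binary (inL s) = step-parent-binary s
step-parent-binary (inR s) = step-parent-binary s

step-exists : ∀ {F c X Y} (p : Pos F) → sub p ≡ bin c X Y → (d : Side) → Σ (Pos F) λ q → Step p q d
step-exists {bin c A B} here refl left = L here , stepL
step-exists {bin c A B} here refl right = R here , stepR
step-exists (L p) eq d = let q , s = step-exists p eq d in L q , inL s
step-exists (R p) eq d = let q , s = step-exists p eq d in R q , inR s

module _ {T : Trees} where

  _≟ᴼ_ : DecidableEquality (Occ T)
  conc i p ≟ᴼ conc j q with i Fin.≟ j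
  ... | no i≢j = no λ { refl → i≢j refl }
  ... | yes refl = map′ (cong (conc i)) (λ { refl → refl }) (p ≟ᴾ q)
  cutL i p ≟ᴼ cutL j q with i Fin.≟ j
  ... | no i≢j = no λ { refl → i≢j refl }
  ... | yes refl = map′ (cong (cutL i)) (λ { refl → refl }) (p ≟ᴾ q)
  cutR i p ≟ᴼ cutR j q with i Fin.≟ j
  ... | no i≢j = no λ { refl → i≢j refl }
  ... | yes refl = map′ (cong (cutR i)) (λ { refl → refl }) (p ≟ᴾ q)
  conc _ _ ≟ᴼ cutL _ _ = no λ ()
  conc _ _ ≟ᴼ cutR _ _ = no λ ()
  cutL _ _ ≟ᴼ conc _ _ = no λ ()
  cutL _ _ ≟ᴼ cutR _ _ = no λ ()
  cutR _ _ ≟ᴼ conc _ _ = no λ ()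
  cutR _ _ ≟ᴼ cutL _ _ = no λ ()

  _≟ᴺ_ : DecidableEquality (Node T)
  occ x ≟ᴺ occ y = map′ (cong occ) (λ { refl → refl }) (x ≟ᴼ y)
  cutN i ≟ᴺ cutN j = map′ (cong cutN) (λ { refl → refl }) (i Fin.≟ j)
  occ _ ≟ᴺ cutN _ = no λ ()
  cutN _ ≟ᴺ occ _ = no λ ()

  child-irreflexive : ∀ {u d} → ¬ Child T u u d
  child-irreflexive (conc-step s) = step-irreflexive s
  child-irreflexive (cutL-step s) = step-irreflexive s
  child-irreflexive (cutR-step s) = step-irreflexive s

  child-functional : ∀ {u v v′ d} → Child T u v d → Child T u v′ d → v ≡ v′
  child-functional (conc-step s) (conc-step s′) = cong (λ q → occ (conc _ q)) (step-functional s s′)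
  child-functional (cutL-step s) (cutL-step s′) = cong (λ q → occ (cutL _ q)) (step-functional s s′)
  child-functional (cutR-step s) (cutR-step s′) = cong (λ q → occ (cutR _ q)) (step-functional s s′)
  child-functional cut-left cut-left = refl
  child-functional cut-right cut-right = refl

  child-side-unique : ∀ {u v} → Child T u v left → ¬ Child T u v right
  child-side-unique (conc-step s) (conc-step s′) = step-side-unique s s′
  child-side-unique (cutL-step s) (cutL-step s′) = step-side-unique s s′
  child-side-unique (cutR-step s) (cutR-step s′) = step-side-unique s s′

  child-parent-binary : ∀ {x v d} → Child T (occ x) v d → IsBinary (fmla x)
  child-parent-binary (conc-step s) = step-parent-binary s
  child-parent-binary (cutL-step s) = step-parent-binary s
  child-parent-binary (cutR-step s) = step-parent-binary s

  atomic⇒childless : ∀ {x v d} → IsAtomic (fmla x) → ¬ Child T (occ x) v d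
  atomic⇒childless at c = binary⇒¬atomic (child-parent-binary c) at

  child-exists : ∀ {c X Y} (x : Occ T) → fmla x ≡ bin c X Y → (d : Side) → Σ (Occ T) λ y → Child T (occ x) (occ y) d
  child-exists (conc i p) eq d = let q , s = step-exists p eq d in conc i q , conc-step s
  child-exists (cutL j p) eq d = let q , s = step-exists p eq d in cutL j q , cutL-step s
  child-exists (cutR j p) eq d = let q , s = step-exists p eq d in cutR j q , cutR-step s

¬¬-shift-Fin : ∀ n (Q : Fin n → Set) → (∀ i → DoubleNegation (Q i)) → DoubleNegation (∀ i → Q i)
¬¬-shift-Fin zero Q h k = k λ ()
¬¬-shift-Fin (suc n) Q h k =
  h zero λ q₀ → ¬¬-shift-Fin n (λ i → Q (suc i)) (λ i → h (suc i)) λ qₛ →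
  k λ { zero → q₀ ; (suc i) → qₛ i }

¬¬-shift-Pos : ∀ F (Q : Pos F → Set) → (∀ p → DoubleNegation (Q p)) → DoubleNegation (∀ p → Q p)
¬¬-shift-Pos (pos _) Q h k = h here λ q → k λ { here → q }
¬¬-shift-Pos (neg _) Q h k = h here λ q → k λ { here → q }
¬¬-shift-Pos (bin c X Y) Q h k =
  h here λ q → ¬¬-shift-Pos X (λ p → Q (L p)) (λ p → h (L p)) λ qL →
  ¬¬-shift-Pos Y (λ p → Q (R p)) (λ p → h (R p)) λ qR →
  k λ { here → q ; (L p) → qL p ; (R p) → qR p }

¬¬-shift-Occ : ∀ {T} (Q : Occ T → Set) → (∀ x → DoubleNegation (Q x)) → DoubleNegation (∀ x → Q x)
¬¬-shift-Occ {T} Q h k =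
  ¬¬-shift-Fin (nc T) _ (λ i → ¬¬-shift-Pos (concl T i) _ (λ p → h (conc i p))) λ qc →
  ¬¬-shift-Fin (nk T) _ (λ j → ¬¬-shift-Pos (cuts T j) _ (λ p → h (cutL j p))) λ ql →
  ¬¬-shift-Fin (nk T) _ (λ j → ¬¬-shift-Pos (cuts T j ᗮ) _ (λ p → h (cutR j p))) λ qr →
  k λ { (conc i p) → qc i p ; (cutL j p) → ql j p ; (cutR j p) → qr j p }

opposite : Side → Side
opposite left = right
opposite right = left

opposite≢ : ∀ d → opposite d ≢ d
opposite≢ left ()
opposite≢ right ()

sides-≢⇒≡ : ∀ {s a b : Side} → s ≢ a → s ≢ b → a ≡ b
sides-≢⇒≡ {left} {left} s≢a _ = ⊥-elim (s≢a refl)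
sides-≢⇒≡ {right} {right} s≢a _ = ⊥-elim (s≢a refl)
sides-≢⇒≡ {left} {_} {left} _ s≢b = ⊥-elim (s≢b refl)
sides-≢⇒≡ {right} {_} {right} _ s≢b = ⊥-elim (s≢b refl)
sides-≢⇒≡ {left} {right} {right} _ _ = refl
sides-≢⇒≡ {right} {left} {left} _ _ = refl

IsPar : Formula → Set
IsPar F = Σ Formula λ X → Σ Formula λ Y → F ≡ bin par X Y

-- Switching graphs, subnets and kingdoms

module NetFacts (π : PreNet) (pn : ProofNet π) where
  private
    T = trees π
  open Walk (_≟ᴺ_ {T}) public

  linked-atomic : ∀ {x y} → Linked π x y → IsAtomic (fmla x) × IsAtomic (fmla y)
  linked-atomic l with linked-dual π l
  ... | _ , inj₁ (eqx , eqy) rewrite eqx | eqy = tt , tt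
  ... | _ , inj₂ (eqx , eqy) rewrite eqx | eqy = tt , tt

  linked-irreflexive : ∀ {x} → ¬ Linked π x x
  linked-irreflexive l with linked-dual π l
  ... | _ , inj₁ (eqx , eqy) with trans (sym eqx) eqy
  ...   | ()
  linked-irreflexive l | _ , inj₂ (eqx , eqy) with trans (sym eqx) eqy
  ...   | ()

  binary⇒unlinked : ∀ {x y} → IsBinary (fmla x) → ¬ Linked π x y
  binary⇒unlinked b l = binary⇒¬atomic b (proj₁ (linked-atomic l))

  module _ {s : Switching π} where

    edge-sym : ∀ {u v} → Edge π s u v → Edge π s v u
    edge-sym (inj₁ k) = inj₂ (inj₁ k)
    edge-sym (inj₂ (inj₁ k)) = inj₁ k
    edge-sym {occ _} {occ _} (inj₂ (inj₂ l)) = inj₂ (inj₂ (linked-sym π l))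

    edge-irreflexive : ∀ {u} → ¬ Edge π s u u
    edge-irreflexive (inj₁ (_ , c , _)) = child-irreflexive c
    edge-irreflexive (inj₂ (inj₁ (_ , c , _))) = child-irreflexive c
    edge-irreflexive {occ _} (inj₂ (inj₂ l)) = linked-irreflexive l

    adj-sym : ∀ {S} → Sym (Adj π S s) (Adj π S s)
    adj-sym (Su , Sv , e) = Sv , Su , edge-sym e

  acyclic : ∀ S s → Acyclic π S s
  acyclic S s (k , v , injective , steps , back) =
    proj₂ (pn s) (k , v , injective , (λ i → tt , tt , proj₂ (proj₂ (steps i))) , (tt , tt , proj₂ (proj₂ back)))

  -- Otherwise a simple subwalk, closed up by the edge x – z, would be a switching cycle.
  return-step : ∀ s {x z} {G : Node T → Node T → Set} → (∀ {a b} → G a b → Edge π s a b) →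
                Edge π s x z → Star G z x → G z x
  return-step s edge e p with simplify p
  ... | ε , _ , _ = ⊥-elim (edge-irreflexive e)
  ... | r ◅ ε , _ , _ = r
  ... | q@(_ ◅ _ ◅ _) , simple , _ =
    ⊥-elim (proj₂ (pn s) (simple-walk-cycle (λ r → tt , tt , edge r) q simple (s≤s (s≤s z≤n)) (tt , tt , e)))

  -- If z is off q, then p (which avoids x) followed by q reversed (which avoids z)
  -- returns from z to x without the edge z – x.
  ∩-walk : ∀ s {S U : NodeSet π} {x u} (p : Star (Adj π S s) x u) → Simple p →
           Star (Adj π U s) x u → U x → Star (Adj π (S ∩ U) s) x u
  ∩-walk s ε _ _ _ = ε
  ∩-walk s {S} {U} {x} {u} (_◅_ {j = z} r p) (x∉p , simple) q Ux with z ∈ʷ? q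
  ... | yes z∈q = ((proj₁ r , Ux) , (proj₁ (proj₂ r) , Uz) , proj₂ (proj₂ r)) ◅ ∩-walk s p simple (proj₁ (suffix q z∈q)) Uz
    where Uz = walk-preserves U (λ r → proj₁ (proj₂ r)) Ux q z z∈q
  ... | no z∉q = ⊥-elim (proj₂ (return-step s proj₁ (proj₂ (proj₂ r)) (along-p ◅◅ along-q)) (refl , refl))
    where
      Avoiding : Node T → Node T → Set
      Avoiding a b = Edge π s a b × ¬ (a ≡ z × b ≡ x)
      along-p : Star Avoiding z u
      along-p = map-within (_≢ x) (λ _ b≢x r → proj₂ (proj₂ r) , λ (_ , b≡x) → b≢x b≡x) p
                  (λ w w∈ w≡x → x∉p (subst (_∈ʷ p) w≡x w∈))
      along-q : Star Avoiding u x
      along-q = map-within (_≢ z) (λ a≢z _ r → proj₂ (proj₂ r) , λ (a≡z , _) → a≢z a≡z) (reverse adj-sym q)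
                  (λ w w∈ w≡z → z∉q (subst (_∈ʷ q) w≡z (∈ʷ-reverse adj-sym q w∈)))

  ∩-subnet : ∀ {S U x} → Subnet π S → Subnet π U → S x → U x → Subnet π (S ∩ U)
  ∩-subnet {S} {U} {x} ((childS , linkS) , correctS , _) ((childU , linkU) , correctU , _) Sx Ux =
    ((λ u v d (Su , Uu) c → childS u v d Su c , childU u v d Uu c) ,
     (λ a b (Sa , Ua) l → linkS a b Sa l , linkU a b Ua l)) ,
    (λ s → connected s , acyclic (S ∩ U) s) , pn
    where
      from-x : ∀ s {w} → S w → U w → Star (Adj π (S ∩ U) s) x w
      from-x s Sw Uw = let p , simple , _ = simplify (proj₁ (correctS s) _ _ Sx Sw)
                       in ∩-walk s p simple (proj₁ (correctU s) _ _ Ux Uw) Ux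
      connected : ∀ s → Connected π (S ∩ U) s
      connected s u v (Su , Uu) (Sv , Uv) = reverse adj-sym (from-x s Su Uu) ◅◅ from-x s Sv Uv

  kingdom⊆subnet : ∀ {B K W} → Kingdom π B K → Subnet π W → W B → K ⊆ W
  kingdom⊆subnet (subK , (KB , no-parent) , minimal) subW WB Ku =
    proj₁ (minimal (_ ∩ _) (∩-subnet subW subK WB KB) ((WB , KB) , λ p d c (_ , Kp) → no-parent p d c Kp) _ Ku)

  Separated : Node T → Node T → Set₁
  Separated B A = Σ (NodeSet π) λ W → Subnet π W × W B × ¬ W A

  separated⇒¬≪ : ∀ {A B} → Separated B A → ¬ _≪_ π A B
  separated⇒¬≪ (W , subW , WB , ¬WA) (K , kB , KA) = ¬WA (kingdom⊆subnet kB subW WB KA)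

  _─_ : NodeSet π → Node T → NodeSet π
  (S ─ a) u = S u × u ≢ a

  adj-⊆ : ∀ {S U : NodeSet π} {s a b} → S ⊆ U → Adj π S s a b → Adj π U s a b
  adj-⊆ S⊆U (Sa , Sb , e) = S⊆U Sa , S⊆U Sb , e

  kept-or-deleted : ∀ F del d → keptAt π F del d ⊎ (IsPar F × del ≡ d)
  kept-or-deleted (pos _) _ _ = inj₁ tt
  kept-or-deleted (neg _) _ _ = inj₁ tt
  kept-or-deleted (bin tens _ _) _ _ = inj₁ tt
  kept-or-deleted (bin par X Y) left left = inj₂ ((X , Y , refl) , refl)
  kept-or-deleted (bin par X Y) right right = inj₂ ((X , Y , refl) , refl)
  kept-or-deleted (bin par _ _) left right = inj₁ λ ()
  kept-or-deleted (bin par _ _) right left = inj₁ λ ()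

  par-or-always-kept : ∀ F → IsPar F ⊎ (∀ del d → keptAt π F del d)
  par-or-always-kept (pos _) = inj₂ λ _ _ → tt
  par-or-always-kept (neg _) = inj₂ λ _ _ → tt
  par-or-always-kept (bin tens _ _) = inj₂ λ _ _ → tt
  par-or-always-kept (bin par X Y) = inj₁ (X , Y , refl)

  some-side-kept : ∀ s u → KeptAt π s u left ⊎ KeptAt π s u right
  some-side-kept s (cutN _) = inj₁ tt
  some-side-kept s (occ x) with kept-or-deleted (fmla x) (s x) left
  ... | inj₁ k = inj₁ k
  ... | inj₂ ((_ , _ , eq) , sx≡left) =
    inj₂ (subst (λ F → keptAt π F (s x) right) (sym eq) λ sx≡right → left≢right (trans (sym sx≡left) sx≡right))
    where
      left≢right : left ≢ right
      left≢right ()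

  AgreeAt : Switching π → Switching π → Node T → Set
  AgreeAt s s′ u = ∀ y → u ≡ occ y → s′ y ≡ s y

  kept-transport : ∀ s s′ {u d} → AgreeAt s s′ u → KeptAt π s u d → KeptAt π s′ u d
  kept-transport s s′ {cutN _} _ k = tt
  kept-transport s s′ {occ y} {d} agree k = subst (λ del → keptAt π (fmla y) del d) (sym (agree y refl)) k

  edge-transport : ∀ s s′ {u v} → AgreeAt s s′ u → AgreeAt s s′ v → Edge π s u v → Edge π s′ u v
  edge-transport s s′ agree-u _ (inj₁ (d , c , k)) = inj₁ (d , c , kept-transport s s′ agree-u k)
  edge-transport s s′ _ agree-v (inj₂ (inj₁ (d , c , k))) = inj₂ (inj₁ (d , c , kept-transport s s′ agree-v k))
  edge-transport s s′ {occ _} {occ _} _ _ (inj₂ (inj₂ l)) = inj₂ (inj₂ l)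

  _[_≔_] : Switching π → Occ T → Side → Switching π
  (s [ x ≔ d ]) y with y ≟ᴼ x
  ... | yes _ = d
  ... | no _ = s y

  update-here : ∀ s x d → (s [ x ≔ d ]) x ≡ d
  update-here s x d with x ≟ᴼ x
  ... | yes _ = refl
  ... | no x≢x = ⊥-elim (x≢x refl)

  update-elsewhere : ∀ s x d y → y ≢ x → (s [ x ≔ d ]) y ≡ s y
  update-elsewhere s x d y y≢x with y ≟ᴼ x
  ... | yes y≡x = ⊥-elim (y≢x y≡x)
  ... | no _ = refl

  IdentityLink : Occ T → Occ T → NodeSet π
  IdentityLink x y u = u ≡ occ x ⊎ u ≡ occ y

  identity-link-subnet : ∀ {x y} → Linked π x y → Subnet π (IdentityLink x y)
  identity-link-subnet {x} {y} link =
    ((λ { _ _ _ (inj₁ refl) c → ⊥-elim (atomic⇒childless x-atomic c)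
        ; _ _ _ (inj₂ refl) c → ⊥-elim (atomic⇒childless y-atomic c) }) ,
     (λ { _ _ (inj₁ refl) l → inj₂ (cong occ (linked-unique π l link))
        ; _ _ (inj₂ refl) l → inj₁ (cong occ (linked-unique π l (linked-sym π link))) })) ,
    (λ s → connected s , acyclic (IdentityLink x y) s) , pn
    where
      x-atomic = proj₁ (linked-atomic link)
      y-atomic = proj₂ (linked-atomic link)
      connected : ∀ s → Connected π (IdentityLink x y) s
      connected s _ _ (inj₁ refl) (inj₁ refl) = ε
      connected s _ _ (inj₂ refl) (inj₂ refl) = ε
      connected s _ _ (inj₁ refl) (inj₂ refl) = (inj₁ refl , inj₂ refl , inj₂ (inj₂ link)) ◅ ε
      connected s _ _ (inj₂ refl) (inj₁ refl) = (inj₂ refl , inj₁ refl , inj₂ (inj₂ (linked-sym π link))) ◅ ε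

  identity-link-door : ∀ {x y} → Linked π x y → Door π (IdentityLink x y) (occ x)
  identity-link-door link = inj₁ refl , λ { _ _ c (inj₁ refl) → child-irreflexive c
                                          ; _ _ c (inj₂ refl) → atomic⇒childless (proj₂ (linked-atomic link)) c }

  atomic-≪ : ∀ {A B K} → IsAtomic (fmla A) → Kingdom π (occ A) K → K (occ B) → A ≡ B ⊎ Linked π A B
  atomic-≪ {A} {B} atomic (_ , _ , minimal) KB with linked-total π A atomic
  ... | _ , link with minimal _ (identity-link-subnet link) (identity-link-door link) (occ B) KB
  ...   | inj₁ refl = inj₁ refl
  ...   | inj₂ refl = inj₂ link

  -- In every switching a ⅋-door has a single neighbour inside the subnet, so it cannot be
  -- an inner vertex of a simple walk there.
  ⅋-door-removable : ∀ {S A X Y} → fmla A ≡ bin par X Y → Subnet π S → Door π S (occ A) →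
                     Subnet π (S ─ occ A)
  ⅋-door-removable {S} {A} {X} {Y} eqA ((childS , linkS) , correctS , _) (_ , no-parent) =
    ((λ u v d (Su , _) c → childS u v d Su c , λ { refl → no-parent u d c Su }) ,
     (λ a b (Sa , _) l → linkS a b Sa l , λ { refl → binary⇒unlinked (par , X , Y , eqA) (linked-sym π l) })) ,
    (λ s → connected s , acyclic (S ─ occ A) s) , pn
    where
      kept-child : ∀ s {w} → S w → Edge π s (occ A) w → Σ Side λ d → Child T (occ A) w d × s A ≢ d
      kept-child s Sw (inj₁ (d , c , k)) = d , c , subst (λ F → keptAt π F (s A) d) eqA k
      kept-child s Sw (inj₂ (inj₁ (d , c , _))) = ⊥-elim (no-parent _ d c Sw)
      kept-child s {occ _} Sw (inj₂ (inj₂ l)) = ⊥-elim (binary⇒unlinked (par , X , Y , eqA) l)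
      kept-child s {cutN _} Sw (inj₂ (inj₂ ()))
      connected : ∀ s → Connected π (S ─ occ A) s
      connected s u v (Su , u≢A) (Sv , v≢A) with simplify (proj₁ (correctS s) u v Su Sv)
      ... | p , simple , _ = map-within _ (λ Pa Pb r → Pa , Pb , proj₂ (proj₂ r)) p avoids-A
        where
          A∉p : ¬ occ A ∈ʷ p
          A∉p A∈p with interior-neighbours p simple A∈p (λ A≡u → u≢A (sym A≡u)) (λ A≡v → v≢A (sym A≡v))
          ... | a , b , (Sa , _ , ea) , (_ , Sb , eb) , a≢b with kept-child s Sa (edge-sym ea) | kept-child s Sb eb
          ...   | _ , ca , sA≢da | _ , cb , sA≢db with sides-≢⇒≡ sA≢da sA≢db
          ...     | refl = a≢b (child-functional ca cb)
          avoids-A : ∀ w → w ∈ʷ p → S w × w ≢ occ A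
          avoids-A w w∈p = walk-preserves S (λ r → proj₁ (proj₂ r)) Su p w w∈p ,
                           λ w≡A → A∉p (subst (_∈ʷ p) w≡A w∈p)

  ⅋-door-separates : ∀ {S A X Y u} → fmla A ≡ bin par X Y → Subnet π S → Door π S (occ A) →
                     S u → u ≢ occ A → Separated u (occ A)
  ⅋-door-separates eqA subS doorS Su u≢A =
    _ , ⅋-door-removable eqA subS doorS , (Su , u≢A) , λ (_ , A≢A) → A≢A refl

-- Splitting a kingdom at a ⊗-door

module TensorDoor (π : PreNet) (pn : ProofNet π) {A X Y} (eqA : fmla A ≡ bin tens X Y)
                  {K : NodeSet π} (subK : Subnet π K) (doorK : Door π K (occ A)) where
  open NetFacts π pn
  private
    T = trees π

  K⁻ : NodeSet π
  K⁻ = K ─ occ A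

  child∈K⁻ : ∀ {u v d} → K u → Child T u v d → K⁻ v
  child∈K⁻ {u} {d = d} Ku c = proj₁ (proj₁ subK) u _ d Ku c , λ { refl → proj₂ doorK u d c Ku }

  always-kept : ∀ s d → KeptAt π s (occ A) d
  always-kept s d = subst (λ F → keptAt π F (s A) d) (sym eqA) tt

  n₁ n₂ : Node T
  n₁ = occ (proj₁ (child-exists A eqA left))
  n₂ = occ (proj₁ (child-exists A eqA right))

  c₁ : Child T (occ A) n₁ left
  c₁ = proj₂ (child-exists A eqA left)

  c₂ : Child T (occ A) n₂ right
  c₂ = proj₂ (child-exists A eqA right)

  Reaches : Node T → Switching π → Node T → Set
  Reaches t s u = K⁻ u × Star (Adj π K⁻ s) u t

  Component : Node T → NodeSet π
  Component t u = ∀ s → Reaches t s u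

  component⊆K⁻ : ∀ {t} → Component t ⊆ K⁻
  component⊆K⁻ E = proj₁ (E λ _ → left)

  step-up : ∀ {t s z u d} → K⁻ z → Child T z u d → KeptAt π s z d → Reaches t s u → Reaches t s z
  step-up K⁻z c k (K⁻u , p) = K⁻z , (K⁻z , K⁻u , inj₁ (_ , c , k)) ◅ p

  step-down : ∀ {t s u v d} → Reaches t s u → Child T u v d → KeptAt π s u d → Reaches t s v
  step-down (K⁻u , p) c k = K⁻v , (K⁻v , K⁻u , inj₂ (inj₁ (_ , c , k))) ◅ p
    where K⁻v = child∈K⁻ (proj₁ K⁻u) c

  -- Closed up by the edges n₁ – A – n₂, such a walk would give a cycle.
  children-separated : ∀ s → ¬ Star (Adj π K⁻ s) n₁ n₂
  children-separated s p =
    proj₂ (return-step s proj₁ (inj₁ (left , c₁ , always-kept s left)) (Star.map leave-n₁ p ◅◅ enter-A ◅ ε)) (refl , refl)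
    where
      Avoiding : Node T → Node T → Set
      Avoiding a b = Edge π s a b × ¬ (a ≡ n₁ × b ≡ occ A)
      leave-n₁ : ∀ {a b} → Adj π K⁻ s a b → Avoiding a b
      leave-n₁ (_ , (_ , b≢A) , e) = e , λ (_ , b≡A) → b≢A b≡A
      enter-A : Avoiding n₂ (occ A)
      enter-A = edge-sym {s = s} (inj₁ (right , c₂ , always-kept s right)) ,
                λ (n₂≡n₁ , _) → child-side-unique c₁ (subst (λ w → Child T (occ A) w right) n₂≡n₁ c₂)

  reaches-a-child : ∀ s {u} → K⁻ u → Reaches n₁ s u ⊎ Reaches n₂ s u
  reaches-a-child s K⁻u = go K⁻u (proj₁ (proj₁ (proj₂ subK) s) _ _ (proj₁ K⁻u) (proj₁ doorK))
    where
      next-to-A : ∀ {u} → K⁻ u → Edge π s u (occ A) → Reaches n₁ s u ⊎ Reaches n₂ s u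
      next-to-A K⁻u (inj₁ (d , c , _)) = ⊥-elim (proj₂ doorK _ d c (proj₁ K⁻u))
      next-to-A K⁻u (inj₂ (inj₁ (left , c , _))) with child-functional c c₁
      ... | refl = inj₁ (K⁻u , ε)
      next-to-A K⁻u (inj₂ (inj₁ (right , c , _))) with child-functional c c₂
      ... | refl = inj₂ (K⁻u , ε)
      next-to-A {occ _} _ (inj₂ (inj₂ l)) = ⊥-elim (binary⇒unlinked (tens , X , Y , eqA) (linked-sym π l))
      next-to-A {cutN _} _ (inj₂ (inj₂ ()))
      go : ∀ {u} → K⁻ u → Star (Adj π K s) u (occ A) → Reaches n₁ s u ⊎ Reaches n₂ s u
      go K⁻u ε = ⊥-elim (proj₂ K⁻u refl)
      go K⁻u (_◅_ {j = z} (_ , Kz , e) p) with z ≟ᴺ occ A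
      ... | yes refl = next-to-A K⁻u e
      ... | no z≢A with go (Kz , z≢A) p
      ...   | inj₁ (_ , q) = inj₁ (K⁻u , (K⁻u , (Kz , z≢A) , e) ◅ q)
      ...   | inj₂ (_ , q) = inj₂ (K⁻u , (K⁻u , (Kz , z≢A) , e) ◅ q)

  component-parent-closed : ∀ {t y ul ur} → K⁻ (occ y) → Child T (occ y) ul left → Child T (occ y) ur right →
                            Component t ul → Component t ur → Component t (occ y)
  component-parent-closed {y = y} K⁻y cl cr El Er s with some-side-kept s (occ y)
  ... | inj₁ k = step-up K⁻y cl k (El s)
  ... | inj₂ k = step-up K⁻y cr k (Er s)

  module ComponentOf (t t′ : Node T) (separated : ∀ s → ¬ Star (Adj π K⁻ s) t t′)
                     (dichotomy : ∀ s {u} → K⁻ u → Reaches t s u ⊎ Reaches t′ s u) where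

    component-link-closed : ∀ a b → Component t (occ a) → Linked π a b → Component t (occ b)
    component-link-closed a b E l s = K⁻b , (K⁻b , proj₁ (E s) , inj₂ (inj₂ (linked-sym π l))) ◅ proj₂ (E s)
      where
        K⁻b : K⁻ (occ b)
        K⁻b = proj₂ (proj₁ subK) a b (proj₁ (proj₁ (E s))) l ,
              λ { refl → binary⇒unlinked (tens , X , Y , eqA) (linked-sym π l) }

    -- If s deletes the edge x – v, flip s at x. A walk from v to t′ under s either passes
    -- through x, which reaches t under s, or is also a walk under the flipped switching,
    -- in which v reaches t.
    component-child-closed : ∀ u v d → Component t u → Child T u v d → Component t v
    component-child-closed (cutN _) v d E c s = step-down (E s) c tt
    component-child-closed (occ x) v d E c s with kept-or-deleted (fmla x) (s x) d
    ... | inj₁ k = step-down (E s) c k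
    ... | inj₂ ((_ , _ , eqx) , _) with dichotomy s (child∈K⁻ (proj₁ (proj₁ (E s))) c)
    ...   | inj₁ reach = reach
    ...   | inj₂ (_ , w) = ⊥-elim contradiction
      where
        s′ = s [ x ≔ opposite d ]
        reach′ : Reaches t s′ v
        reach′ = step-down (E s′) c (subst (λ F → keptAt π F (s′ x) d) (sym eqx)
                   (subst (_≢ d) (sym (update-here s x (opposite d))) (opposite≢ d)))
        flip : ∀ {a b} → a ≢ occ x → b ≢ occ x → Adj π K⁻ s a b → Adj π K⁻ s′ a b
        flip a≢x b≢x (K⁻a , K⁻b , e) = K⁻a , K⁻b , edge-transport s s′ (away a≢x) (away b≢x) e
          where
            away : ∀ {a} → a ≢ occ x → AgreeAt s s′ a
            away a≢x y a≡y = update-elsewhere s x (opposite d) y λ y≡x → a≢x (trans a≡y (cong occ y≡x))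
        contradiction : ⊥
        contradiction with occ x ∈ʷ? w
        ... | yes x∈w = separated s (reverse adj-sym (proj₂ (E s)) ◅◅ proj₁ (suffix w x∈w))
        ... | no x∉w = separated s′ (reverse adj-sym (proj₂ reach′) ◅◅
                         map-within (_≢ occ x) flip w λ y y∈w y≡x → x∉w (subst (_∈ʷ w) y≡x y∈w))

    module _ (decide : ∀ y → Dec (Component t (occ y))) (s : Switching π) where

      -- Outside the component a ⅋-node deletes its edge towards the component (the left one
      -- when in doubt), so that no kept edge leaves the component.
      guard : Switching π
      guard y with decide y | binary-or-atomic (fmla y)
      ... | yes _ | _ = s y
      ... | no _ | inj₂ _ = left
      ... | no _ | inj₁ (_ , _ , _ , eq) with decide (proj₁ (child-exists y eq left))
      ...   | yes _ = left
      ...   | no _ = right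

      guard-agrees : ∀ {u} → Component t u → AgreeAt guard s u
      guard-agrees Eu y u≡y with decide y
      ... | yes _ = refl
      ... | no ¬Ey = ⊥-elim (¬Ey (subst (Component t) u≡y Eu))

      guard-deletes : ∀ y {X Y u d} → ¬ Component t (occ y) → fmla y ≡ bin par X Y → K⁻ (occ y) →
                      Child T (occ y) u d → Component t u → guard y ≡ d
      guard-deletes y ¬Ey eqy K⁻y c Eu with decide y | binary-or-atomic (fmla y)
      ... | yes Ey | _ = ⊥-elim (¬Ey Ey)
      ... | no _ | inj₂ atomic = ⊥-elim (binary⇒¬atomic (par , _ , _ , eqy) atomic)
      ... | no _ | inj₁ (_ , _ , _ , eq) with decide (proj₁ (child-exists y eq left))
      guard-deletes y {d = left} _ _ _ _ _ | no _ | inj₁ _ | yes _ = refl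
      guard-deletes y {d = right} _ _ _ _ _ | no _ | inj₁ _ | no _ = refl
      guard-deletes y {d = right} ¬Ey _ K⁻y c Eu | no _ | inj₁ (_ , _ , _ , eq) | yes El =
        ⊥-elim (¬Ey (component-parent-closed K⁻y (proj₂ (child-exists y eq left)) c El Eu))
      guard-deletes y {d = left} _ _ _ c Eu | no _ | inj₁ (_ , _ , _ , eq) | no ¬El =
        ⊥-elim (¬El (subst (Component t) (child-functional c (proj₂ (child-exists y eq left))) Eu))

      guard-closed : ∀ {u z} → Component t u → K⁻ z → Edge π guard u z → Component t z
      guard-closed {u} {z} Eu _ (inj₁ (d , c , _)) = component-child-closed u z d Eu c
      guard-closed {occ a} {occ b} Eu _ (inj₂ (inj₂ l)) = component-link-closed a b Eu l
      guard-closed {cutN _} _ _ (inj₂ (inj₂ ()))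
      guard-closed {occ _} {cutN _} _ _ (inj₂ (inj₂ ()))
      guard-closed {z = cutN _} Eu K⁻z (inj₂ (inj₁ (_ , c , _))) s′ = step-up K⁻z c tt (Eu s′)
      guard-closed {z = occ y} Eu K⁻z (inj₂ (inj₁ (d , c , k))) with par-or-always-kept (fmla y)
      ... | inj₂ always = λ s′ → step-up K⁻z c (always (s′ y) d) (Eu s′)
      ... | inj₁ (_ , _ , eqy) = by-cases (decide y)
        where
          by-cases : Dec (Component t (occ y)) → Component t (occ y)
          by-cases (yes Ey) = Ey
          by-cases (no ¬Ey) = ⊥-elim (subst (λ F → keptAt π F (guard y) d) eqy k (guard-deletes y ¬Ey eqy K⁻z c Eu))

      walk-to-t : ∀ {u} → Component t u → Star (Adj π K⁻ guard) u t → Star (Adj π (Component t) s) u t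
      walk-to-t Eu ε = ε
      walk-to-t Eu ((_ , K⁻z , e) ◅ p) =
        (Eu , Ez , edge-transport guard s (guard-agrees Eu) (guard-agrees Ez) e) ◅ walk-to-t Ez p
        where Ez = guard-closed Eu K⁻z e

      component-connected : Connected π (Component t) s
      component-connected u v Eu Ev =
        walk-to-t Eu (proj₂ (Eu guard)) ◅◅ reverse adj-sym (walk-to-t Ev (proj₂ (Ev guard)))

    component-subnet : (∀ y → Dec (Component t (occ y))) → Subnet π (Component t)
    component-subnet decide =
      (component-child-closed , component-link-closed) ,
      (λ s → component-connected decide s , acyclic (Component t) s) , pn

  module C₁ = ComponentOf n₁ n₂ children-separated reaches-a-child
  module C₂ = ComponentOf n₂ n₁ (λ s p → children-separated s (reverse adj-sym p))
                                (λ s K⁻u → Sum.swap (reaches-a-child s K⁻u))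

  Split : NodeSet π
  Split u = u ≡ occ A ⊎ Component n₁ u ⊎ Component n₂ u

  split-subnet : (∀ y → Dec (Component n₁ (occ y))) → (∀ y → Dec (Component n₂ (occ y))) → Subnet π Split
  split-subnet decide₁ decide₂ = (split-child-closed , split-link-closed) , (λ s → connected s , acyclic Split s) , pn
    where
      n₁∈C₁ : Component n₁ n₁
      n₁∈C₁ s = child∈K⁻ (proj₁ doorK) c₁ , ε
      n₂∈C₂ : Component n₂ n₂
      n₂∈C₂ s = child∈K⁻ (proj₁ doorK) c₂ , ε
      split-child-closed : ∀ u v d → Split u → Child T u v d → Split v
      split-child-closed _ _ left (inj₁ refl) c with child-functional c c₁
      ... | refl = inj₂ (inj₁ n₁∈C₁)
      split-child-closed _ _ right (inj₁ refl) c with child-functional c c₂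
      ... | refl = inj₂ (inj₂ n₂∈C₂)
      split-child-closed u v d (inj₂ (inj₁ E)) c = inj₂ (inj₁ (C₁.component-child-closed u v d E c))
      split-child-closed u v d (inj₂ (inj₂ E)) c = inj₂ (inj₂ (C₂.component-child-closed u v d E c))
      split-link-closed : ∀ a b → Split (occ a) → Linked π a b → Split (occ b)
      split-link-closed a b (inj₁ refl) l = ⊥-elim (binary⇒unlinked (tens , X , Y , eqA) l)
      split-link-closed a b (inj₂ (inj₁ E)) l = inj₂ (inj₁ (C₁.component-link-closed a b E l))
      split-link-closed a b (inj₂ (inj₂ E)) l = inj₂ (inj₂ (C₂.component-link-closed a b E l))
      to-A : ∀ s {u} → Split u → Star (Adj π Split s) u (occ A)
      to-A s (inj₁ refl) = ε
      to-A s (inj₂ (inj₁ E)) =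
        Star.map (adj-⊆ (λ E′ → inj₂ (inj₁ E′))) (C₁.component-connected decide₁ s _ _ E n₁∈C₁) ◅◅
        (inj₂ (inj₁ n₁∈C₁) , inj₁ refl , edge-sym {s = s} (inj₁ (left , c₁ , always-kept s left))) ◅ ε
      to-A s (inj₂ (inj₂ E)) =
        Star.map (adj-⊆ (λ E′ → inj₂ (inj₂ E′))) (C₂.component-connected decide₂ s _ _ E n₂∈C₂) ◅◅
        (inj₂ (inj₂ n₂∈C₂) , inj₁ refl , edge-sym {s = s} (inj₁ (right , c₂ , always-kept s right))) ◅ ε
      connected : ∀ s → Connected π Split s
      connected s u v Su Sv = to-A s Su ◅◅ reverse adj-sym (to-A s Sv)

  split-door : Door π Split (occ A)
  split-door = inj₁ refl , λ { _ _ c (inj₁ refl) → child-irreflexive c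
                             ; p d c (inj₂ (inj₁ E)) → proj₂ doorK p d c (proj₁ (component⊆K⁻ E))
                             ; p d c (inj₂ (inj₂ E)) → proj₂ doorK p d c (proj₁ (component⊆K⁻ E)) }

  -- The components are not decidable constructively, but the goal is a negation.
  ⊗-door-separates : (∀ S → Subnet π S → Door π S (occ A) → ∀ u → K u → S u) →
                     ∀ {u} → K u → u ≢ occ A → DoubleNegation (Separated u (occ A))
  ⊗-door-separates minimal Ku u≢A ¬separated =
    ¬¬-shift-Occ _ (λ _ → ¬¬-excluded-middle) λ decide₁ →
    ¬¬-shift-Occ _ (λ _ → ¬¬-excluded-middle) λ decide₂ →
    in-split decide₁ decide₂ (minimal Split (split-subnet decide₁ decide₂) split-door _ Ku)
    where
      in-split : (∀ y → Dec (Component n₁ (occ y))) → (∀ y → Dec (Component n₂ (occ y))) → Split _ → ⊥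
      in-split _ _ (inj₁ u≡A) = u≢A u≡A
      in-split decide₁ _ (inj₂ (inj₁ E)) =
        ¬separated (_ , C₁.component-subnet decide₁ , E , λ EA → proj₂ (component⊆K⁻ EA) refl)
      in-split _ decide₂ (inj₂ (inj₂ E)) =
        ¬separated (_ , C₂.component-subnet decide₂ , E , λ EA → proj₂ (component⊆K⁻ EA) refl)

lemma2p29 : (π : PreNet) → ProofNet π → (A B : Occ (trees π)) →
    _≪_ π (occ A) (occ B) → _≪_ π (occ B) (occ A) →
    A ≡ B ⊎ Linked π A B
lemma2p29 π pn A B A≪B (K , kA@(subK , doorK , minimal) , B∈K) with occ B ≟ᴺ occ A | binary-or-atomic (fmla A)
... | yes refl | _ = inj₁ refl
... | no _ | inj₂ atomic = atomic-≪ atomic kA B∈K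
  where open NetFacts π pn
... | no B≢A | inj₁ (par , _ , _ , eqA) =
  ⊥-elim (separated⇒¬≪ (⅋-door-separates eqA subK doorK B∈K B≢A) A≪B)
  where open NetFacts π pn
... | no B≢A | inj₁ (tens , _ , _ , eqA) =
  ⊥-elim (⊗-door-separates minimal B∈K B≢A (λ separated → separated⇒¬≪ separated A≪B))
  where
    open NetFacts π pn
    open TensorDoor π pn eqA subK doorK
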